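{- Let $m\geq 8$ be even and let $n$ be a positive integer with $n\equiv 4 \pmod{m/2}$. Then for every tree $T_n$ on $n$ vertices with maximum degree $\Delta(T_n)=n-3$, we have $R(T_n,W_m)\geq 2n+m/2-4$.
   Context: All graphs are finite, simple, undirected. For graphs $G,H$, the Ramsey number $R(G,H)$ is the smallest positive integer $N$ such that for every graph $F$ on $N$ vertices, either $F$ contains a subgraph isomorphic to $G$ or the complement $\overline{F}$ contains a subgraph isomorphic to $H$. $W_m$ is the wheel on $m+1$ vertices: a cycle $C_m$ plus one extra vertex adjacent to all vertices of the cycle. -}

module Defs where

open import Data.Nat using (ℕ; zero; suc; _+_; _≤_; _⊔_; _≡ᵇ_)
open import Data.Bool using (Bool; true; false; not; _∧_; _∨_; if_then_else_)
open import Data.Fin using (Fin; zero; suc; toℕ; inject₁; fromℕ)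
open import Data.List using (List; allFin; map; foldr)
open import Data.Nat.ListAction using (sum)
open import Data.Sum using (_⊎_)
open import Data.Product using (Σ; ∃; _×_; _,_)
open import Relation.Binary.PropositionalEquality using (_≡_)
open import Relation.Nullary using (¬_)
open import Function.Definitions using (Injective)

record Graph (n : ℕ) : Set where
  field
    adj    : Fin n → Fin n → Bool
    sym    : ∀ u v → adj u v ≡ adj v u
    irrefl : ∀ v → adj v v ≡ false
open Graph public

degree : ∀ {n} → Graph n → Fin n → ℕ
degree G v = sum (map (λ w → if adj G v w then 1 else 0) (allFin _))

maxDegree : ∀ {n} → Graph n → ℕ
maxDegree G = foldr _⊔_ 0 (map (degree G) (allFin _))

data Walk {n} (G : Graph n) : Fin n → Fin n → Set where
  here : ∀ {u} → Walk G u u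
  step : ∀ {u w v} → adj G u w ≡ true → Walk G w v → Walk G u v

Connected : ∀ {n} → Graph n → Set
Connected G = ∀ u v → Walk G u v

HasCycle : ∀ {n} → Graph n → Set
HasCycle {n} G = Σ ℕ λ k → Σ (Fin (3 + k) → Fin n) λ c →
  Injective _≡_ _≡_ c ×
  (∀ (i : Fin (2 + k)) → adj G (c (inject₁ i)) (c (suc i)) ≡ true) ×
  adj G (c (fromℕ (2 + k))) (c zero) ≡ true

IsTree : ∀ {n} → Graph n → Set
IsTree G = Connected G × ¬ HasCycle G

-- Pattern graphs given by an adjacency relation on Fin k.
-- F contains a copy of H (as a subgraph, not necessarily induced).
Contains : ∀ {N k} → Graph N → (Fin k → Fin k → Bool) → Set
Contains {N} {k} F H = Σ (Fin k → Fin N) λ f →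
  Injective _≡_ _≡_ f × (∀ i j → H i j ≡ true → adj F (f i) (f j) ≡ true)

ComplementContains : ∀ {N k} → Graph N → (Fin k → Fin k → Bool) → Set
ComplementContains {N} {k} F H = Σ (Fin k → Fin N) λ f →
  Injective _≡_ _≡_ f × (∀ i j → H i j ≡ true → adj F (f i) (f j) ≡ false)

-- Wheel W_m on Fin (suc m): vertex zero is the hub, vertices suc i
-- (i = 0..m-1) form the cycle C_m with i ~ i+1 (mod m).
cycAdj : (m : ℕ) → Fin m → Fin m → Bool
cycAdj m i j = (toℕ j ≡ᵇ suc (toℕ i)) ∨ ((suc (toℕ i) ≡ᵇ m) ∧ (toℕ j ≡ᵇ 0))

wheel : (m : ℕ) → Fin (suc m) → Fin (suc m) → Bool
wheel m zero    zero    = false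
wheel m zero    (suc j) = true
wheel m (suc i) zero    = true
wheel m (suc i) (suc j) = cycAdj m i j ∨ cycAdj m j i

RamseyProperty : ∀ {a b} → (Fin a → Fin a → Bool) → (Fin b → Fin b → Bool) → ℕ → Set
RamseyProperty G H N = (F : Graph N) → Contains F G ⊎ ComplementContains F H

-- R(G,H) ≥ r : every N with the Ramsey property satisfies r ≤ N
-- (R(G,H) is the least such N).
RamseyGE : ∀ {a b} → (Fin a → Fin a → Bool) → (Fin b → Fin b → Bool) → ℕ → Set
RamseyGE G H r = ∀ N → RamseyProperty G H N → r ≤ N

-- Write h = m / 2, n = 4 + k h and a = n - 1.  The graph F = K_a ∪ K_{(k+1) × h}
-- (a clique beside a complete multipartite graph with k + 1 parts of size h)
-- has a + (k + 1) h = 2n + h - 5 vertices.  A tree on n vertices is connected,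
-- so a copy of it lies in one component: not in K_a, which is too small, and
-- not in the multipartite part, whose degrees are k h = n - 4 < Δ(T).  The
-- complement of F is an independent set of size a joined completely to k + 1
-- disjoint copies of K_h.  A wheel W_{2h} there with its hub in the independent
-- set has its whole rim inside one K_h, which is too small; with its hub in a
-- copy of K_h, at most h - 1 rim vertices share that copy and no two
-- consecutive rim vertices lie in the independent set, so the rim has at most
-- 2h - 1 vertices.
module Submission where

open import Defs
open import Algebra.Properties.CommutativeSemigroup using (x∙yz≈y∙xz)
open import Data.Bool using (Bool; true; false; not; _∧_; if_then_else_)
open import Data.Bool.Properties using (T-≡; not-injective)
open import Data.Empty using (⊥; ⊥-elim)
open import Data.Fin
  using (Fin; zero; suc; toℕ; inject₁; inject≤; splitAt; join; quotient; remainder; combine; _↑ˡ_; _↑ʳ_)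
open import Data.Fin.Induction using (<-weakInduction)
import Data.Fin.Properties as Fin
open import Data.Integer using (+_; _-_)
open import Data.Integer.Divisibility using (_∣_)
open import Data.List using (tabulate)
open import Data.List.Properties using (map-tabulate; foldr-preservesᵇ)
open import Data.List.Relation.Unary.All.Properties using (map⁺; tabulate⁺)
open import Data.Nat using (ℕ; zero; suc; _+_; _*_; _∸_; _≤_; _<_; z≤n; s≤s; s≤s⁻¹; _/_; _%_; _≤?_)
open import Data.Nat.DivMod using (m≡m%n+[m/n]*n; /-monoˡ-≤)
open import Data.Nat.Divisibility using (divides; ∣⇒≤)
open import Data.Nat.ListAction using (sum)
open import Data.Nat.Properties
  using ( +-assoc; +-comm; +-identityʳ; +-suc; *-suc; *-comm; *-zeroʳ; *-identityˡ; *-distribʳ-+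
        ; +-mono-≤; +-cancelˡ-≡; ≤-refl; ≤-reflexive; ≤-trans; n≤1+n; n<1+n; m<m+n
        ; <⇒≱; ≰⇒>; ⊔-lub; ≡⇒≡ᵇ; +-commutativeSemigroup; module ≤-Reasoning)
open import Data.Nat.Tactic.RingSolver using (solve-∀)
open import Data.Product using (Σ; ∃; _×_; _,_; proj₁; proj₂)
open import Data.Sum using (_⊎_; inj₁; inj₂; [_,_]′)
import Data.Sum as Sum
open import Function using (_∘_; id; Equivalence)
open import Function.Definitions using (Injective)
open import Relation.Binary.PropositionalEquality
  using (_≡_; _≢_; refl; trans; cong; cong₂; subst; subst₂; module ≡-Reasoning)
import Relation.Binary.PropositionalEquality as ≡
open import Relation.Nullary using (¬_; does; yes; no)
open import Relation.Nullary.Decidable using (dec-true; dec-false)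

indicator : Bool → ℕ
indicator b = if b then 1 else 0

count : ∀ n → (Fin n → Bool) → ℕ
count zero    P = 0
count (suc n) P = indicator (P zero) + count n (P ∘ suc)

count-cong : ∀ n {P Q : Fin n → Bool} → (∀ i → P i ≡ Q i) → count n P ≡ count n Q
count-cong zero    P≗Q = refl
count-cong (suc n) P≗Q = cong₂ _+_ (cong indicator (P≗Q zero)) (count-cong n (P≗Q ∘ suc))

count-const : ∀ n b → count n (λ _ → b) ≡ indicator b * n
count-const zero    b = ≡.sym (*-zeroʳ (indicator b))
count-const (suc n) b = trans (cong (_+_ (indicator b)) (count-const n b)) (≡.sym (*-suc (indicator b) n))

count-true : ∀ n → count n (λ _ → true) ≡ n
count-true n = trans (count-const n true) (*-identityˡ n)

count-+ : ∀ m n (P : Fin (m + n) → Bool) →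
  count (m + n) P ≡ count m (P ∘ (_↑ˡ n)) + count n (P ∘ (m ↑ʳ_))
count-+ zero    n P = refl
count-+ (suc m) n P =
  trans (cong (_+_ (indicator (P zero))) (count-+ m n (P ∘ suc))) (≡.sym (+-assoc (indicator (P zero)) _ _))

count-complement : ∀ n (P : Fin n → Bool) → count n P + count n (not ∘ P) ≡ n
count-complement zero    P = refl
count-complement (suc n) P with P zero
... | true  = cong suc (count-complement n (P ∘ suc))
... | false = trans (+-suc _ _) (cong suc (count-complement n (P ∘ suc)))

count-blocks : ∀ q h (P : Fin q → Bool) → count (q * h) (P ∘ quotient h) ≡ count q P * h
count-blocks zero    h P = refl
count-blocks (suc q) h P = begin
  count (h + q * h) (P ∘ quotient h)
    ≡⟨ count-+ h (q * h) (P ∘ quotient h) ⟩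
  count h (P ∘ quotient h ∘ (_↑ˡ q * h)) + count (q * h) (P ∘ quotient h ∘ (h ↑ʳ_))
    ≡⟨ cong₂ _+_ (count-cong h (cong P ∘ first-block)) (count-cong (q * h) (cong P ∘ later-block)) ⟩
  count h (λ _ → P zero) + count (q * h) (P ∘ suc ∘ quotient {q} h)
    ≡⟨ cong₂ _+_ (count-const h (P zero)) (count-blocks q h (P ∘ suc)) ⟩
  indicator (P zero) * h + count q (P ∘ suc) * h
    ≡⟨ *-distribʳ-+ h (indicator (P zero)) (count q (P ∘ suc)) ⟨
  count (suc q) P * h ∎
  where
  open ≡-Reasoning
  first-block : ∀ i → quotient {suc q} h (i ↑ˡ q * h) ≡ zero
  first-block i rewrite Fin.splitAt-↑ˡ h i (q * h) = refl
  later-block : ∀ j → quotient {suc q} h (h ↑ʳ j) ≡ suc (quotient {q} h j)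
  later-block j rewrite Fin.splitAt-↑ʳ h (q * h) j = refl

_≠ᵇ_ : ∀ {n} → Fin n → Fin n → Bool
x ≠ᵇ y = not (does (x Fin.≟ y))

≠ᵇ-irrefl : ∀ {n} (x : Fin n) → x ≠ᵇ x ≡ false
≠ᵇ-irrefl x = cong not (dec-true (x Fin.≟ x) refl)

≠ᵇ-sym : ∀ {n} (x y : Fin n) → x ≠ᵇ y ≡ y ≠ᵇ x
≠ᵇ-sym x y with x Fin.≟ y | y Fin.≟ x
... | yes _   | yes _   = refl
... | no  _   | no  _   = refl
... | yes x≡y | no  y≢x = ⊥-elim (y≢x (≡.sym x≡y))
... | no  x≢y | yes y≡x = ⊥-elim (x≢y (≡.sym y≡x))

≢⇒≠ᵇ : ∀ {n} {x y : Fin n} → x ≢ y → x ≠ᵇ y ≡ true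
≢⇒≠ᵇ {x = x} {y} x≢y = cong not (dec-false (x Fin.≟ y) x≢y)

≠ᵇ-false⇒≡ : ∀ {n} {x y : Fin n} → x ≠ᵇ y ≡ false → x ≡ y
≠ᵇ-false⇒≡ {x = x} {y} _ with x Fin.≟ y
≠ᵇ-false⇒≡ _  | yes x≡y = x≡y
≠ᵇ-false⇒≡ () | no  _

count-remove : ∀ n (P : Fin n → Bool) y → count n P ≡ indicator (P y) + count n (λ z → z ≠ᵇ y ∧ P z)
count-remove (suc n) P zero    = refl
count-remove (suc n) P (suc y) =
  trans (cong (_+_ (indicator (P zero))) (count-remove n (P ∘ suc) y))
        (x∙yz≈y∙xz +-commutativeSemigroup (indicator (P zero)) (indicator (P (suc y))) _)

count-≠ᵇ : ∀ n (y : Fin (suc n)) → count (suc n) (_≠ᵇ y) ≡ n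
count-≠ᵇ n       zero    = count-true n
count-≠ᵇ (suc n) (suc y) = cong suc (count-≠ᵇ n y)

count-mono-injective : ∀ m n (f : Fin m → Fin n) {P : Fin m → Bool} {Q : Fin n → Bool} →
  (∀ {x y} → P x ≡ true → P y ≡ true → f x ≡ f y → x ≡ y) →
  (∀ {x} → P x ≡ true → Q (f x) ≡ true) →
  count m P ≤ count n Q
count-mono-injective zero    n f inj pres = z≤n
count-mono-injective (suc m) n f {P} {Q} inj pres with P zero in P0
... | false = count-mono-injective m n (f ∘ suc) (λ px py → Fin.suc-injective ∘ inj px py) pres
... | true  = begin
  suc (count m (P ∘ suc))
    ≤⟨ s≤s (count-mono-injective m n (f ∘ suc) {Q = Q′}
             (λ px py → Fin.suc-injective ∘ inj px py) pres′) ⟩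
  suc (count n Q′)
    ≡⟨ cong (λ b → indicator b + count n Q′) (pres P0) ⟨
  indicator (Q (f zero)) + count n Q′
    ≡⟨ count-remove n Q (f zero) ⟨
  count n Q ∎
  where
  open ≤-Reasoning
  Q′ : Fin n → Bool
  Q′ z = z ≠ᵇ f zero ∧ Q z
  pres′ : ∀ {x} → P (suc x) ≡ true → Q′ (f (suc x)) ≡ true
  pres′ px = cong₂ _∧_ (≢⇒≠ᵇ (λ e → Fin.0≢1+n (inj P0 px (≡.sym e)))) (pres px)

degree≡count : ∀ {n} (G : Graph n) v → degree G v ≡ count n (adj G v)
degree≡count {n} G v = trans (cong sum (map-tabulate id (indicator ∘ adj G v))) (sum-tabulate n (adj G v))
  where
  sum-tabulate : ∀ n (P : Fin n → Bool) → sum (tabulate (indicator ∘ P)) ≡ count n P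
  sum-tabulate zero    P = refl
  sum-tabulate (suc n) P = cong (_+_ (indicator (P zero))) (sum-tabulate n (P ∘ suc))

maxDegree-≤ : ∀ {n} (G : Graph n) {d} → (∀ v → degree G v ≤ d) → maxDegree G ≤ d
maxDegree-≤ G {d} bound = foldr-preservesᵇ {P = _≤ d} ⊔-lub z≤n (map⁺ (tabulate⁺ bound))

-- Contains F H is Embeds (adj F) true H, and ComplementContains F H is Embeds (adj F) false H.
Embeds : ∀ {V : Set} {k} → (V → V → Bool) → Bool → (Fin k → Fin k → Bool) → Set
Embeds {V} {k} R b H =
  Σ (Fin k → V) λ f → Injective _≡_ _≡_ f × (∀ i j → H i j ≡ true → R (f i) (f j) ≡ b)

Embeds-map : ∀ {U V : Set} {R : V → V → Bool} {b k} {H : Fin k → Fin k → Bool} (g : U → V) →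
  Injective _≡_ _≡_ g → Embeds (λ u v → R (g u) (g v)) b H → Embeds R b H
Embeds-map g g-inj (f , f-inj , f-hom) = g ∘ f , f-inj ∘ g-inj , f-hom

injective-of-factor : ∀ {A B C : Set} {f : A → C} (ι : B → C) (g : A → B) →
  (∀ x → f x ≡ ι (g x)) → Injective _≡_ _≡_ f → Injective _≡_ _≡_ g
injective-of-factor ι g f≗ι∘g f-inj {x} {y} gx≡gy =
  f-inj (trans (f≗ι∘g x) (trans (cong ι gx≡gy) (≡.sym (f≗ι∘g y))))

restrict : ∀ {N N′} → N ≤ N′ → Graph N′ → Graph N
restrict N≤N′ F = record
  { adj    = λ u v → adj F (inject≤ u N≤N′) (inject≤ v N≤N′)
  ; sym    = λ u v → Graph.sym F _ _
  ; irrefl = λ v → Graph.irrefl F _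
  }

RamseyProperty-mono : ∀ {a b} {G : Fin a → Fin a → Bool} {H : Fin b → Fin b → Bool} {N N′} →
  N ≤ N′ → RamseyProperty G H N → RamseyProperty G H N′
RamseyProperty-mono {N = N} {N′} N≤N′ ramsey F =
  Sum.map (Embeds-map {R = adj F} ι ι-injective) (Embeds-map {R = adj F} ι ι-injective)
    (ramsey (restrict N≤N′ F))
  where
  ι : Fin N → Fin N′
  ι v = inject≤ v N≤N′
  ι-injective : Injective _≡_ _≡_ ι
  ι-injective = Fin.inject≤-injective N≤N′ N≤N′ _ _

RamseyGE-from-graph : ∀ {a b} {G : Fin a → Fin a → Bool} {H : Fin b → Fin b → Bool} {N} (F : Graph N) →
  ¬ Contains F G → ¬ ComplementContains F H → RamseyGE G H (suc N)
RamseyGE-from-graph {N = N} F G⊈F H⊈F̄ N′ ramsey with suc N ≤? N′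
... | yes N<N′ = N<N′
... | no  N≮N′ = ⊥-elim ([ G⊈F , H⊈F̄ ]′ (RamseyProperty-mono (s≤s⁻¹ (≰⇒> N≮N′)) ramsey F))

-- The clique K_a beside the complete multipartite graph K_{(k+1) × h}, h = suc h′

module CliqueBesideMultipartite (a k h′ : ℕ) where

  h : ℕ
  h = suc h′

  Vertex : Set
  Vertex = Fin a ⊎ Fin (suc k * h)

  part : Fin (suc k * h) → Fin (suc k)
  part = quotient h

  index : Fin (suc k * h) → Fin h
  index = remainder {suc k} h

  part-index-injective : ∀ {c c′} → part c ≡ part c′ → index c ≡ index c′ → c ≡ c′
  part-index-injective {c} {c′} p r =
    trans (≡.sym (Fin.combine-remQuot {suc k} h c)) (trans (cong₂ combine p r) (Fin.combine-remQuot h c′))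

  related : Vertex → Vertex → Bool
  related (inj₁ x) (inj₁ y) = x ≠ᵇ y
  related (inj₂ c) (inj₂ d) = part c ≠ᵇ part d
  related (inj₁ _) (inj₂ _) = false
  related (inj₂ _) (inj₁ _) = false

  related-sym : ∀ u v → related u v ≡ related v u
  related-sym (inj₁ x) (inj₁ y) = ≠ᵇ-sym x y
  related-sym (inj₂ c) (inj₂ d) = ≠ᵇ-sym (part c) (part d)
  related-sym (inj₁ _) (inj₂ _) = refl
  related-sym (inj₂ _) (inj₁ _) = refl

  related-irrefl : ∀ v → related v v ≡ false
  related-irrefl (inj₁ x) = ≠ᵇ-irrefl x
  related-irrefl (inj₂ c) = ≠ᵇ-irrefl (part c)

  graph : Graph (a + suc k * h)
  graph = record
    { adj    = λ u v → related (splitAt a u) (splitAt a v)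
    ; sym    = λ u v → related-sym (splitAt a u) (splitAt a v)
    ; irrefl = λ v → related-irrefl (splitAt a v)
    }

  graph-embeds : ∀ {b m} {H : Fin m → Fin m → Bool} → Embeds (adj graph) b H → Embeds related b H
  graph-embeds = Embeds-map {R = related} (splitAt a) splitAt-injective
    where
    splitAt-injective : Injective _≡_ _≡_ (splitAt a)
    splitAt-injective {u} {v} e =
      trans (≡.sym (Fin.join-splitAt a _ u)) (trans (cong (join a _) e) (Fin.join-splitAt a _ v))

  inClique : Vertex → Bool
  inClique (inj₁ _) = true
  inClique (inj₂ _) = false

  clique-vertex : ∀ v → inClique v ≡ true → Σ (Fin a) λ x → v ≡ inj₁ x
  clique-vertex (inj₁ x) _ = x , refl

  multipartite-vertex : ∀ v → inClique v ≡ false → Σ (Fin (suc k * h)) λ c → v ≡ inj₂ c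
  multipartite-vertex (inj₂ c) _ = c , refl

  related⇒same-side : ∀ u v → related u v ≡ true → inClique u ≡ inClique v
  related⇒same-side (inj₁ _) (inj₁ _) _ = refl
  related⇒same-side (inj₂ _) (inj₂ _) _ = refl

  unrelated⇒same-part : ∀ c d → related (inj₂ c) (inj₂ d) ≡ false → part c ≡ part d
  unrelated⇒same-part _ _ = ≠ᵇ-false⇒≡

  unrelated-to-clique : ∀ u v → inClique u ≡ true → related u v ≡ false → u ≢ v → inClique v ≡ false
  unrelated-to-clique (inj₁ x) (inj₁ y) _ x≈y x≢y = ⊥-elim (x≢y (cong inj₁ (≠ᵇ-false⇒≡ x≈y)))
  unrelated-to-clique (inj₁ _) (inj₂ _) _ _   _   = refl

  -- Trees

  walk-preserves-side : ∀ {n} {T : Graph n} (f : Fin n → Vertex) →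
    (∀ i j → adj T i j ≡ true → related (f i) (f j) ≡ true) →
    ∀ {u v} → Walk T u v → inClique (f u) ≡ inClique (f v)
  walk-preserves-side f f-hom here                 = refl
  walk-preserves-side f f-hom (step {u} {w} uw rest) =
    trans (related⇒same-side (f u) (f w) (f-hom u w uw)) (walk-preserves-side f f-hom rest)

  clique-embedding-≤ : ∀ {n} (f : Fin n → Vertex) → Injective _≡_ _≡_ f →
    (∀ w → inClique (f w) ≡ true) → n ≤ a
  clique-embedding-≤ f f-inj in-clique =
    Fin.injective⇒≤ (injective-of-factor inj₁ (proj₁ ∘ on-clique) (proj₂ ∘ on-clique) f-inj)
    where
    on-clique : ∀ w → Σ (Fin a) λ x → f w ≡ inj₁ x
    on-clique w = clique-vertex (f w) (in-clique w)

  multipartite-embedding-maxDegree-≤ : ∀ {n} (T : Graph n) (f : Fin n → Vertex) → Injective _≡_ _≡_ f →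
    (∀ i j → adj T i j ≡ true → related (f i) (f j) ≡ true) →
    (∀ w → inClique (f w) ≡ false) → maxDegree T ≤ k * h
  multipartite-embedding-maxDegree-≤ {n} T f f-inj f-hom outside = maxDegree-≤ T degree-≤
    where
    on-multipartite : ∀ w → Σ (Fin (suc k * h)) λ c → f w ≡ inj₂ c
    on-multipartite w = multipartite-vertex (f w) (outside w)
    c : Fin n → Fin (suc k * h)
    c = proj₁ ∘ on-multipartite
    f≡c : ∀ w → f w ≡ inj₂ (c w)
    f≡c = proj₂ ∘ on-multipartite
    c-injective : Injective _≡_ _≡_ c
    c-injective = injective-of-factor inj₂ c f≡c f-inj
    neighbour-in-other-part : ∀ x {w} → adj T x w ≡ true → part (c w) ≠ᵇ part (c x) ≡ true
    neighbour-in-other-part x {w} xw = trans (≠ᵇ-sym (part (c w)) (part (c x)))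
      (subst₂ (λ u v → related u v ≡ true) (f≡c x) (f≡c w) (f-hom x w xw))
    degree-≤ : ∀ x → degree T x ≤ k * h
    degree-≤ x = begin
      degree T x
        ≡⟨ degree≡count T x ⟩
      count n (adj T x)
        ≤⟨ count-mono-injective n _ c {adj T x} {(_≠ᵇ part (c x)) ∘ part}
             (λ _ _ → c-injective) (neighbour-in-other-part x) ⟩
      count (suc k * h) ((_≠ᵇ part (c x)) ∘ part)
        ≡⟨ count-blocks (suc k) h (_≠ᵇ part (c x)) ⟩
      count (suc k) (_≠ᵇ part (c x)) * h
        ≡⟨ cong (_* h) (count-≠ᵇ k (part (c x))) ⟩
      k * h ∎
      where open ≤-Reasoning

  tree-free : ∀ {n} (T : Graph n) → a < n → Connected T → k * h < maxDegree T →
    ¬ Embeds related true (adj T)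
  tree-free {suc n} T a<n connected kh<Δ (f , f-inj , f-hom) = one-side-impossible (inClique (f zero)) side
    where
    side : ∀ w → inClique (f w) ≡ inClique (f zero)
    side w = ≡.sym (walk-preserves-side f f-hom (connected zero w))
    one-side-impossible : ∀ s → (∀ w → inClique (f w) ≡ s) → ⊥
    one-side-impossible true  in-clique = <⇒≱ a<n (clique-embedding-≤ f f-inj in-clique)
    one-side-impossible false outside   = <⇒≱ kh<Δ (multipartite-embedding-maxDegree-≤ T f f-inj f-hom outside)

  -- Wheels in the complement

  module _ (f : Fin (suc (h + h)) → Vertex) (f-inj : Injective _≡_ _≡_ f)
           (f-unrel : ∀ i j → wheel (h + h) i j ≡ true → related (f i) (f j) ≡ false) where

    rim : Fin (h + h) → Vertex
    rim = f ∘ suc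

    rim-injective : Injective _≡_ _≡_ rim
    rim-injective = Fin.suc-injective ∘ f-inj

    hub≢rim : ∀ j → f zero ≢ rim j
    hub≢rim j = Fin.0≢1+n ∘ f-inj

    rim-unrelated : ∀ j → related (rim (inject₁ j)) (rim (suc j)) ≡ false
    rim-unrelated j = f-unrel (suc (inject₁ j)) (suc (suc j)) (wheel-rim-edge j)
      where
      wheel-rim-edge : ∀ {m} (j : Fin m) → wheel (suc m) (suc (inject₁ j)) (suc (suc j)) ≡ true
      wheel-rim-edge j rewrite Fin.toℕ-inject₁ j
                             | Equivalence.to T-≡ (≡⇒≡ᵇ (toℕ j) (toℕ j) refl) = refl

    clique-hub-impossible : ∀ x → f zero ≡ inj₁ x → ⊥
    clique-hub-impossible x hub = <⇒≱ (m<m+n h (s≤s z≤n)) (Fin.injective⇒≤ index∘c-injective)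
      where
      on-multipartite : ∀ j → Σ (Fin (suc k * h)) λ c → rim j ≡ inj₂ c
      on-multipartite j = multipartite-vertex (rim j)
        (unrelated-to-clique (f zero) (rim j) (cong inClique hub) (f-unrel zero (suc j) refl) (hub≢rim j))
      c : Fin (h + h) → Fin (suc k * h)
      c = proj₁ ∘ on-multipartite
      rim≡c : ∀ j → rim j ≡ inj₂ (c j)
      rim≡c = proj₂ ∘ on-multipartite
      c-injective : Injective _≡_ _≡_ c
      c-injective = injective-of-factor inj₂ c rim≡c rim-injective
      same-part : ∀ j → part (c j) ≡ part (c zero)
      same-part = <-weakInduction (λ j → part (c j) ≡ part (c zero)) refl λ j ih →
        trans (≡.sym (unrelated⇒same-part (c (inject₁ j)) (c (suc j))
                        (subst₂ (λ u v → related u v ≡ false) (rim≡c (inject₁ j)) (rim≡c (suc j))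
                                (rim-unrelated j))))
              ih
      index∘c-injective : Injective _≡_ _≡_ (index ∘ c)
      index∘c-injective {i} {j} e =
        c-injective (part-index-injective (trans (same-part i) (≡.sym (same-part j))) e)

    multipartite-hub-impossible : ∀ c₀ → f zero ≡ inj₂ c₀ → ⊥
    multipartite-hub-impossible c₀ hub = <⇒≱ (n<1+n (h′ + h)) (begin
      h + h                                   ≡⟨ count-complement (h + h) in-clique ⟨
      count (h + h) in-clique + #outside      ≤⟨ +-mono-≤ in-clique-≤ outside-≤ ⟩
      (1 + #outside) + h′                     ≤⟨ +-mono-≤ (s≤s outside-≤) ≤-refl ⟩
      suc h′ + h′                             ≡⟨ +-suc h′ h′ ⟨
      h′ + h                                  ∎)
      where
      open ≤-Reasoning
      in-clique : Fin (h + h) → Bool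
      in-clique = inClique ∘ rim
      #outside : ℕ
      #outside = count (h + h) (not ∘ in-clique)
      in-hub-part : ∀ j → in-clique j ≡ false →
        Σ (Fin (suc k * h)) λ d → rim j ≡ inj₂ d × part d ≡ part c₀
      in-hub-part j outside with multipartite-vertex (rim j) outside
      ... | d , rim≡d = d , rim≡d , ≡.sym (unrelated⇒same-part c₀ d
        (subst₂ (λ u v → related u v ≡ false) hub rim≡d (f-unrel zero (suc j) refl)))
      -- The value on clique vertices is irrelevant: only rim vertices outside the clique are counted.
      rank : Vertex → Fin h
      rank (inj₁ _) = zero
      rank (inj₂ d) = index d
      rank-injective : ∀ {i j} → not (in-clique i) ≡ true → not (in-clique j) ≡ true →
        rank (rim i) ≡ rank (rim j) → i ≡ j
      rank-injective {i} {j} oi oj e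
        with in-hub-part i (not-injective oi) | in-hub-part j (not-injective oj)
      ... | d , rim≡d , d∈ | d′ , rim≡d′ , d′∈ rewrite rim≡d | rim≡d′ =
        rim-injective (trans rim≡d (trans (cong inj₂ (part-index-injective (trans d∈ (≡.sym d′∈)) e))
                                          (≡.sym rim≡d′)))
      rank≢hub : ∀ {j} → not (in-clique j) ≡ true → rank (rim j) ≠ᵇ index c₀ ≡ true
      rank≢hub {j} oj with in-hub-part j (not-injective oj)
      ... | d , rim≡d , d∈ rewrite rim≡d = ≢⇒≠ᵇ λ e →
        hub≢rim j (trans hub (trans (cong inj₂ (part-index-injective (≡.sym d∈) (≡.sym e)))
                                    (≡.sym rim≡d)))
      outside-≤ : #outside ≤ h′
      outside-≤ = ≤-trans
        (count-mono-injective (h + h) h (rank ∘ rim) {not ∘ in-clique} {_≠ᵇ index c₀}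
          rank-injective rank≢hub)
        (≤-reflexive (count-≠ᵇ h′ (index c₀)))
      predecessor-outside : ∀ {j} → in-clique (suc j) ≡ true → not (in-clique (inject₁ j)) ≡ true
      predecessor-outside {j} ic = cong not (unrelated-to-clique (rim (suc j)) (rim (inject₁ j)) ic
        (trans (related-sym (rim (suc j)) (rim (inject₁ j))) (rim-unrelated j))
        (λ e → Fin.<⇒≢ (Fin.≤̄⇒inject₁< Fin.≤-refl) (rim-injective (≡.sym e))))
      in-clique-≤ : count (h + h) in-clique ≤ 1 + #outside
      in-clique-≤ = +-mono-≤ (indicator≤1 (in-clique zero))
        (count-mono-injective (h′ + h) (h + h) inject₁ {in-clique ∘ suc} {not ∘ in-clique}
          (λ _ _ → Fin.inject₁-injective) predecessor-outside)
        where
        indicator≤1 : ∀ b → indicator b ≤ 1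
        indicator≤1 true  = ≤-refl
        indicator≤1 false = z≤n

  complement-wheel-free : ¬ Embeds related false (wheel (h + h))
  complement-wheel-free (f , f-inj , f-unrel) with f zero in hub
  ... | inj₁ x = clique-hub-impossible f f-inj f-unrel x hub
  ... | inj₂ c = multipartite-hub-impossible f f-inj f-unrel c hub

ramseyGE-tree-wheel : ∀ {h} k → 1 ≤ h → (T : Graph (4 + k * h)) → Connected T →
  maxDegree T + 3 ≡ 4 + k * h →
  RamseyGE (adj T) (wheel (h + h)) (2 * (4 + k * h) + h ∸ 4)
ramseyGE-tree-wheel {suc h′} k (s≤s z≤n) T connected Δ+3≡n =
  subst (RamseyGE (adj T) (wheel (h + h))) (order (k * h) h)
    (RamseyGE-from-graph graph (tree-free T ≤-refl connected kh<Δ ∘ graph-embeds)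
                               (complement-wheel-free ∘ graph-embeds))
  where
  open CliqueBesideMultipartite (3 + k * suc h′) k h′
  kh<Δ : k * h < maxDegree T
  kh<Δ = ≤-reflexive (≡.sym (+-cancelˡ-≡ 3 _ _ (trans (+-comm 3 (maxDegree T)) Δ+3≡n)))
  -- The right-hand side is what 2 * (4 + x) + h ∸ 4 reduces to.
  order : ∀ x h → 4 + (x + (h + x)) ≡ x + (4 + x + 0) + h
  order = solve-∀

even⇒≡half+half : ∀ {m} → m % 2 ≡ 0 → m ≡ m / 2 + m / 2
even⇒≡half+half {m} m%2≡0 = begin
  m                    ≡⟨ m≡m%n+[m/n]*n m 2 ⟩
  m % 2 + m / 2 * 2    ≡⟨ cong (_+ m / 2 * 2) m%2≡0 ⟩
  m / 2 * 2            ≡⟨ *-comm (m / 2) 2 ⟩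
  m / 2 + (m / 2 + 0)  ≡⟨ cong (_+_ (m / 2)) (+-identityʳ (m / 2)) ⟩
  m / 2 + m / 2        ∎
  where open ≡-Reasoning

≡4+multiple : ∀ {h n} → 4 ≤ h → 1 ≤ n → + h ∣ (+ n - + 4) → ∃ λ k → n ≡ 4 + k * h
≡4+multiple {n = 1} 4≤h _ h∣3 = ⊥-elim (<⇒≱ 4≤h (∣⇒≤ h∣3))
≡4+multiple {n = 2} 4≤h _ h∣2 = ⊥-elim (<⇒≱ 4≤h (≤-trans (∣⇒≤ h∣2) (n≤1+n 2)))
≡4+multiple {n = 3} 4≤h _ h∣1 = ⊥-elim (<⇒≱ 4≤h (≤-trans (∣⇒≤ h∣1) (≤-trans (n≤1+n 1) (n≤1+n 2))))
≡4+multiple {n = suc (suc (suc (suc d)))} _ _ (divides k d≡k*h) = k , cong (_+_ 4) d≡k*h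

theorem2 : ∀ (m n : ℕ) → 8 ≤ m → m % 2 ≡ 0 → 1 ≤ n →
    (+ (m / 2)) ∣ (+ n - + 4) →
    (T : Graph n) → IsTree T → maxDegree T + 3 ≡ n →
    RamseyGE (adj T) (wheel m) (2 * n + m / 2 ∸ 4)
theorem2 m n 8≤m m-even 1≤n h∣n-4 T (connected , _) Δ+3≡n
  with 4≤h ← /-monoˡ-≤ 2 8≤m
  with k , refl ← ≡4+multiple 4≤h 1≤n h∣n-4 =
  subst (λ m′ → RamseyGE (adj T) (wheel m′) (2 * (4 + k * (m / 2)) + m / 2 ∸ 4))
    (≡.sym (even⇒≡half+half m-even))
    (ramseyGE-tree-wheel k (≤-trans (s≤s z≤n) 4≤h) T connected Δ+3≡n)
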